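{- An end $\omega$ of a graph $G$ is linear if and only if the ray graph $RG_G(\mathcal{R})$ of every finite family $\mathcal{R}$ of disjoint $\omega$-rays is a path.
   Context: A ray is a one-way infinite path; two rays are equivalent if there are infinitely many vertex-disjoint paths between them, the classes being the ends; an $\omega$-ray is a ray in the end $\omega$. For a finite family $\mathcal{R}=(R_i\colon i\in I)$ of disjoint rays in $G$, the ray graph $RG_G(\mathcal{R})$ has vertex set $I$, with $i$ and $j$ adjacent iff there is an infinite collection of vertex-disjoint paths from $R_i$ to $R_j$ in $G$ which meet no other $R_k$. An end $\omega$ of $G$ is linear if for every finite set $\mathcal{R}$ of at least three disjoint $\omega$-rays in $G$ the elements can be ordered $R_1,\dots,R_n$ so that for all $1\le k<i<\ell\le n$ the rays $R_k$ and $R_\ell$ belong to different ends of $G-V(R_i)$. -}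

module Defs where

open import Level using (0ℓ)
open import Data.Nat using (ℕ; zero; suc; _≤_; _<_)
open import Data.Fin using (Fin; toℕ; inject₁; fromℕ) renaming (suc to fsuc)
open import Data.Product using (Σ; ∃; _×_; _,_)
open import Data.Empty using (⊥)
open import Relation.Nullary using (¬_)
open import Relation.Binary.PropositionalEquality using (_≡_; _≢_)
open import Function.Bundles using (_↔_; _⇔_; Inverse)

record Graph : Set₁ where
  field
    V      : Set
    E      : V → V → Set
    sym    : ∀ {u v} → E u v → E v u
    irrefl : ∀ {v} → ¬ E v v

module _ (G : Graph) where
  open Graph G

  record Ray : Set where
    field
      f   : ℕ → V
      inj : ∀ {m n} → f m ≡ f n → m ≡ n
      adj : ∀ n → E (f n) (f (suc n))

  record Path : Set where
    field
      len  : ℕ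
      vert : Fin (suc len) → V
      inj  : ∀ {i j} → vert i ≡ vert j → i ≡ j
      adj  : ∀ (i : Fin len) → E (vert (inject₁ i)) (vert (fsuc i))

    first : V
    first = vert Data.Fin.zero

    last : V
    last = vert (fromℕ len)

  _∈R_ : V → Ray → Set
  v ∈R R = ∃ λ n → Ray.f R n ≡ v

  _∈P_ : V → Path → Set
  v ∈P P = ∃ λ i → Path.vert P i ≡ v

  DisjointRays : Ray → Ray → Set
  DisjointRays R R' = ∀ v → v ∈R R → ¬ (v ∈R R')

  DisjointPaths : Path → Path → Set
  DisjointPaths P Q = ∀ v → v ∈P P → ¬ (v ∈P Q)

  PathBetweenAvoiding : (V → Set) → Ray → Ray → Path → Set
  PathBetweenAvoiding C R R' P =
    (Path.first P ∈R R) × (Path.last P ∈R R') × (∀ v → v ∈P P → ¬ C v)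

  InfDisjointPathsAvoiding : (V → Set) → Ray → Ray → Set
  InfDisjointPathsAvoiding C R R' =
    Σ (ℕ → Path) λ P →
      (∀ m n → m ≢ n → DisjointPaths (P m) (P n)) ×
      (∀ n → PathBetweenAvoiding C R R' (P n))

  NoVertices : V → Set
  NoVertices _ = ⊥

  Equiv : Ray → Ray → Set
  Equiv = InfDisjointPathsAvoiding NoVertices

  EquivIn-G-minus : (V → Set) → Ray → Ray → Set
  EquivIn-G-minus C = InfDisjointPathsAvoiding C

  record End : Set₁ where
    field
      _∋_      : Ray → Set
      nonempty : Σ Ray _∋_
      isClass  : ∀ R R' → _∋_ R → (_∋_ R' ⇔ Equiv R R')

  DisjointFamilyOf : End → (n : ℕ) → (Fin n → Ray) → Set
  DisjointFamilyOf ω n R =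
    (∀ i → End._∋_ ω (R i)) × (∀ i j → i ≢ j → DisjointRays (R i) (R j))

  VR : Ray → V → Set
  VR R v = v ∈R R

  OtherRays : {n : ℕ} → (Fin n → Ray) → Fin n → Fin n → V → Set
  OtherRays R i j v = ∃ λ k → k ≢ i × k ≢ j × (v ∈R R k)

  RayGraphAdj : {n : ℕ} → (Fin n → Ray) → Fin n → Fin n → Set
  RayGraphAdj R i j = i ≢ j × InfDisjointPathsAvoiding (OtherRays R i j) (R i) (R j)

  Linear : End → Set
  Linear ω = ∀ (n : ℕ) (R : Fin n → Ray) → 3 ≤ n → DisjointFamilyOf ω n R →
    Σ (Fin n ↔ Fin n) λ σ →
      ∀ (k i l : Fin n) → toℕ k < toℕ i → toℕ i < toℕ l →
        ¬ EquivIn-G-minus (VR (R (Inverse.to σ i)))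
                          (R (Inverse.to σ k)) (R (Inverse.to σ l))

IsPathGraph : (n : ℕ) → (Fin n → Fin n → Set) → Set
IsPathGraph n A =
  Σ (Fin n ↔ Fin n) λ σ →
    ∀ a b → A (Inverse.to σ a) (Inverse.to σ b) ⇔
            ((suc (toℕ a) ≡ toℕ b) Data.Sum.⊎ (suc (toℕ b) ≡ toℕ a))
  where import Data.Sum

-- Split the rays of a disjoint family by a set S of indices. If infinitely many disjoint paths run
-- from rays in S to rays outside S, each contains a segment from a ray in S to a ray outside S whose
-- interior meets no ray of the family; by pigeonhole infinitely many of these segments join the same
-- two rays, which are therefore adjacent in the ray graph across the cut.
-- In a linear order of the rays no edge R_a R_b with a + 1 < b exists, as its paths would avoid
-- R_(a+1); and R_a R_(a+1) is an edge, because cutting the infinitely many paths between these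
-- equivalent rays at {≤ a} yields an edge across the cut, which can only be this one. Conversely, if
-- the ray graph is the path R_0 … R_(n-1), cutting paths from R_k to R_l in G − R_i (k < i < l) at
-- {< i} would yield an edge from below i to a ray other than R_i at or above i, which is no edge of
-- the path.
module Submission where

open import Defs
open import Level using (0ℓ)
open import Data.Nat using (ℕ; zero; suc; _≤_; _<_; _+_; _∸_; _⊔_; _⊓_; z≤n; s≤s; s≤s⁻¹; _≤?_)
open import Data.Nat.Properties
open import Data.Nat.Induction using (<-rec)
open import Data.Fin using (Fin; toℕ; fromℕ<; fromℕ; inject₁) renaming (zero to fzero; suc to fsuc)
open import Data.Fin.Properties
  using (toℕ-injective; toℕ<n; toℕ≤pred[n]; toℕ-fromℕ<; fromℕ<-toℕ; toℕ-inject₁; toℕ-fromℕ; *↔×)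
open import Data.Product using (Σ; ∃; ∃₂; _×_; _,_; proj₁; proj₂)
open import Data.Sum using (_⊎_; inj₁; inj₂)
open import Data.Empty using (⊥-elim)
open import Relation.Nullary using (¬_; yes; no; contradiction)
open import Relation.Binary.PropositionalEquality
open import Relation.Binary using (tri<; tri≈; tri>)
open import Function using (_∘_)
open import Function.Bundles using (_⇔_; _↔_; Inverse; Injection; mk⇔; Equivalence)
open import Function.Properties.Inverse using (↔⇒↣)
open import Function.Construct.Identity using (↔-id)
open import Function.Construct.Composition using (_⇔-∘_)
open import Function.Construct.Symmetry using (⇔-sym)
open import Axiom.ExcludedMiddle using (ExcludedMiddle)
open import Axiom.DoubleNegationElimination using (em⇒dne)

InfinitelyOften : (ℕ → Set) → Set
InfinitelyOften P = ∀ m → ∃ λ n → m ≤ n × P n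

upper-bound : ∀ {k} (B : Fin k → ℕ) → ∃ λ M → ∀ x → B x ≤ M
upper-bound {zero}  B = 0 , λ ()
upper-bound {suc k} B with upper-bound (B ∘ fsuc)
... | M , bounded = B fzero ⊔ M , λ
  { fzero    → m≤m⊔n (B fzero) M
  ; (fsuc x) → ≤-trans (bounded x) (m≤n⊔m (B fzero) M) }

infinite-subsequence : ∀ {P : ℕ → Set} → InfinitelyOften P →
                       ∃ λ g → (∀ {m m'} → g m ≡ g m' → m ≡ m') × (∀ m → P (g m))
infinite-subsequence {P} often = g , g-injective , g-satisfies
  where
  g : ℕ → ℕ
  g zero    = proj₁ (often 0)
  g (suc m) = proj₁ (often (suc (g m)))

  g-satisfies : ∀ m → P (g m)
  g-satisfies zero    = proj₂ (proj₂ (often 0))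
  g-satisfies (suc m) = proj₂ (proj₂ (often (suc (g m))))

  g-step : ∀ m → g m < g (suc m)
  g-step m = proj₁ (proj₂ (often (suc (g m))))

  g-increasing : ∀ {m m'} → m < m' → g m < g m'
  g-increasing {m} {suc m'} (s≤s m≤m') with m≤n⇒m<n∨m≡n m≤m'
  ... | inj₁ m<m' = <-trans (g-increasing m<m') (g-step m')
  ... | inj₂ refl = g-step m

  g-injective : ∀ {m m'} → g m ≡ g m' → m ≡ m'
  g-injective {m} {m'} eq with <-cmp m m'
  ... | tri< m<m' _ _ = contradiction eq (<⇒≢ (g-increasing m<m'))
  ... | tri≈ _ m≡m' _ = m≡m'
  ... | tri> _ _ m'<m = contradiction (sym eq) (<⇒≢ (g-increasing m'<m))

module Classical (em : ExcludedMiddle 0ℓ) where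

  dne : {P : Set} → ¬ ¬ P → P
  dne = em⇒dne em

  least-witness : {T : ℕ → Set} → ∀ L → T L → ∃ λ j → T j × (∀ k → k < j → ¬ T k)
  least-witness {T} = <-rec _ search
    where
    search : ∀ L → (∀ {k} → k < L → T k → ∃ λ j → T j × (∀ k → k < j → ¬ T k)) →
             T L → ∃ λ j → T j × (∀ k → k < j → ¬ T k)
    search L below tL with em {∃ λ k → k < L × T k}
    ... | yes (k , k<L , tk) = below k<L tk
    ... | no ¬earlier        = L , tL , λ k k<L tk → ¬earlier (k , k<L , tk)

  greatest-witness : {A : ℕ → Set} → A 0 → ∀ j →
                     ∃ λ i → i ≤ j × A i × (∀ k → i < k → k ≤ j → ¬ A k)
  greatest-witness a₀ zero = 0 , z≤n , a₀ , λ k 0<k k≤0 _ → <⇒≱ 0<k k≤0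
  greatest-witness {A} a₀ (suc j) with em {A (suc j)}
  ... | yes a = suc j , ≤-refl , a , λ k j<k k≤j _ → <⇒≱ j<k k≤j
  ... | no ¬a with greatest-witness a₀ j
  ...   | i , i≤j , aᵢ , above = i , m≤n⇒m≤1+n i≤j , aᵢ , above′
    where
    above′ : ∀ k → i < k → k ≤ suc j → ¬ A k
    above′ k i<k k≤1+j with m≤n⇒m<n∨m≡n k≤1+j
    ... | inj₁ k<1+j = above k i<k (s≤s⁻¹ k<1+j)
    ... | inj₂ refl  = ¬a

  eventually-not : {P : ℕ → Set} → ¬ InfinitelyOften P → ∃ λ m → ∀ n → m ≤ n → ¬ P n
  eventually-not ¬often = dne λ ¬bound →
    ¬often λ m → dne λ ¬later → ¬bound (m , λ n m≤n pₙ → ¬later (n , m≤n , pₙ))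

  infinite-pigeonhole : ∀ {k} {C : Set} → Fin k ↔ C → (c : ℕ → C) →
                        ∃ λ x → InfinitelyOften (λ n → c n ≡ x)
  infinite-pigeonhole enum c = dne λ ¬some →
    let bound : ∀ x → ∃ λ m → ∀ n → m ≤ n → c n ≢ x
        bound x = eventually-not (¬some ∘ (x ,_))
        M , below-M = upper-bound (proj₁ ∘ bound ∘ Inverse.to enum)
        x = c M
        bound≤M = subst (λ y → proj₁ (bound y) ≤ M) (Inverse.strictlyInverseˡ enum x)
                        (below-M (Inverse.from enum x))
    in proj₂ (bound x) M bound≤M refl

module Paths (G : Graph) where
  open Graph G using (V; E) renaming (sym to E-sym)

  infix 4 _∈ᵣ_ _∈ₚ_

  _∈ᵣ_ : V → Ray G → Set
  _∈ᵣ_ = _∈R_ G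

  _∈ₚ_ : V → Path G → Set
  _∈ₚ_ = _∈P_ G

  InjectiveOn : (ℕ → V) → ℕ → Set
  InjectiveOn f L = ∀ {k k'} → k ≤ L → k' ≤ L → f k ≡ f k' → k ≡ k'

  AdjacentOn : (ℕ → V) → ℕ → Set
  AdjacentOn f L = ∀ k → k < L → E (f k) (f (suc k))

  fromSequence : (f : ℕ → V) (L : ℕ) → InjectiveOn f L → AdjacentOn f L → Path G
  fromSequence f L inj adj = record
    { len  = L
    ; vert = f ∘ toℕ
    ; inj  = λ {i} {j} e → toℕ-injective (inj (toℕ≤pred[n] i) (toℕ≤pred[n] j) e)
    ; adj  = λ i → subst (λ u → E u (f (suc (toℕ i)))) (cong f (sym (toℕ-inject₁ i)))
                         (adj (toℕ i) (toℕ<n i))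
    }

  module _ (P : Path G) where
    open Path P renaming (len to L; inj to vert-injective; adj to vert-adjacent)

    -- Beyond the end of P, vertexAt returns the last vertex.
    vertexAt : ℕ → V
    vertexAt k = vert (fromℕ< (s≤s (m⊓n≤n k L)))

    vertexAt-∈ : ∀ k → vertexAt k ∈ₚ P
    vertexAt-∈ k = _ , refl

    vertexAt-fromℕ< : ∀ {k} (k≤L : k ≤ L) → vertexAt k ≡ vert (fromℕ< (s≤s k≤L))
    vertexAt-fromℕ< {k} k≤L = cong vert (toℕ-injective (begin
      toℕ (fromℕ< (s≤s (m⊓n≤n k L))) ≡⟨ toℕ-fromℕ< (s≤s (m⊓n≤n k L)) ⟩
      k ⊓ L                           ≡⟨ m≤n⇒m⊓n≡m k≤L ⟩
      k                               ≡⟨ toℕ-fromℕ< (s≤s k≤L) ⟨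
      toℕ (fromℕ< (s≤s k≤L))          ∎))
      where open ≡-Reasoning

    vertexAt-toℕ : ∀ x → vertexAt (toℕ x) ≡ vert x
    vertexAt-toℕ x = trans (vertexAt-fromℕ< (toℕ≤pred[n] x)) (cong vert (fromℕ<-toℕ x _))

    vertexAt-injective : InjectiveOn vertexAt L
    vertexAt-injective k≤L k'≤L e = begin
      _                         ≡⟨ toℕ-fromℕ< (s≤s k≤L) ⟨
      toℕ (fromℕ< (s≤s k≤L))   ≡⟨ cong toℕ (vert-injective fromℕ<-equal) ⟩
      toℕ (fromℕ< (s≤s k'≤L))  ≡⟨ toℕ-fromℕ< (s≤s k'≤L) ⟩
      _                         ∎
      where
      open ≡-Reasoning
      fromℕ<-equal = trans (sym (vertexAt-fromℕ< k≤L)) (trans e (vertexAt-fromℕ< k'≤L))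

    vertexAt-adjacent : AdjacentOn vertexAt L
    vertexAt-adjacent k k<L = subst₂ E (vert≡vertexAt (trans (toℕ-inject₁ y) (toℕ-fromℕ< k<L)))
                                       (vert≡vertexAt (cong suc (toℕ-fromℕ< k<L)))
                                       (vert-adjacent y)
      where
      y = fromℕ< k<L
      vert≡vertexAt : ∀ {x k} → toℕ x ≡ k → vert x ≡ vertexAt k
      vert≡vertexAt {x} refl = sym (vertexAt-toℕ x)

    vertexAt-first : vertexAt 0 ≡ first
    vertexAt-first = vertexAt-toℕ fzero

    vertexAt-last : vertexAt L ≡ last
    vertexAt-last = trans (cong vertexAt (sym (toℕ-fromℕ L))) (vertexAt-toℕ (fromℕ L))

    subpath : ∀ {i j} → i ≤ j → j ≤ L → Path G
    subpath {i} {j} i≤j j≤L = fromSequence (vertexAt ∘ (i +_)) (j ∸ i) shifted-injective shifted-adjacent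
      where
      in-range : ∀ {k} → k ≤ j ∸ i → i + k ≤ L
      in-range k≤j∸i = ≤-trans (+-monoʳ-≤ i k≤j∸i) (≤-trans (≤-reflexive (m+[n∸m]≡n i≤j)) j≤L)
      shifted-injective : InjectiveOn (vertexAt ∘ (i +_)) (j ∸ i)
      shifted-injective k≤ k'≤ e = +-cancelˡ-≡ i _ _ (vertexAt-injective (in-range k≤) (in-range k'≤) e)
      shifted-adjacent : AdjacentOn (vertexAt ∘ (i +_)) (j ∸ i)
      shifted-adjacent k k< = subst (E (vertexAt (i + k)) ∘ vertexAt) (sym (+-suc i k))
                                    (vertexAt-adjacent (i + k) (subst (_≤ L) (+-suc i k) (in-range k<)))

    module _ {i j} (i≤j : i ≤ j) (j≤L : j ≤ L) where

      subpath-first : Path.first (subpath i≤j j≤L) ≡ vertexAt i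
      subpath-first = cong vertexAt (+-identityʳ i)

      subpath-last : Path.last (subpath i≤j j≤L) ≡ vertexAt j
      subpath-last = cong vertexAt (trans (cong (i +_) (toℕ-fromℕ (j ∸ i))) (m+[n∸m]≡n i≤j))

      ∈-subpath : ∀ {v} → v ∈ₚ subpath i≤j j≤L → ∃ λ k → i ≤ k × k ≤ j × vertexAt k ≡ v
      ∈-subpath (x , eq) = i + toℕ x , m≤m+n i (toℕ x) ,
                           ≤-trans (+-monoʳ-≤ i (toℕ≤pred[n] x)) (≤-reflexive (m+[n∸m]≡n i≤j)) , eq

    reverse : Path G
    reverse = fromSequence (vertexAt ∘ (L ∸_)) L reversed-injective reversed-adjacent
      where
      reversed-injective : InjectiveOn (vertexAt ∘ (L ∸_)) L
      reversed-injective {k} {k'} k≤L k'≤L e = begin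
        k             ≡⟨ m∸[m∸n]≡n k≤L ⟨
        L ∸ (L ∸ k)   ≡⟨ cong (L ∸_) (vertexAt-injective (m∸n≤m L k) (m∸n≤m L k') e) ⟩
        L ∸ (L ∸ k')  ≡⟨ m∸[m∸n]≡n k'≤L ⟩
        k'            ∎
        where open ≡-Reasoning
      reversed-adjacent : AdjacentOn (vertexAt ∘ (L ∸_)) L
      reversed-adjacent k k<L =
        subst (λ l → E (vertexAt l) (vertexAt (L ∸ suc k))) (sym L∸k≡1+L∸1+k)
              (E-sym (vertexAt-adjacent (L ∸ suc k) (subst (_≤ L) L∸k≡1+L∸1+k (m∸n≤m L k))))
        where
        L∸k≡1+L∸1+k : L ∸ k ≡ suc (L ∸ suc k)
        L∸k≡1+L∸1+k = +-∸-assoc 1 k<L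

    reverse-first : Path.first reverse ≡ last
    reverse-first = vertexAt-last

    reverse-last : Path.last reverse ≡ first
    reverse-last = trans (cong vertexAt (trans (cong (L ∸_) (toℕ-fromℕ L)) (n∸n≡0 L))) vertexAt-first

    ∈-reverse : ∀ {v} → v ∈ₚ reverse → v ∈ₚ P
    ∈-reverse (x , refl) = vertexAt-∈ (L ∸ toℕ x)

Consecutive : ∀ {n} → Fin n → Fin n → Set
Consecutive a b = suc (toℕ a) ≡ toℕ b ⊎ suc (toℕ b) ≡ toℕ a

module RayGraphs (G : Graph) where
  open Paths G

  InfDisjointPathsAvoiding-mono : ∀ {C C' R R'} → (∀ v → C' v → C v) →
    InfDisjointPathsAvoiding G C R R' → InfDisjointPathsAvoiding G C' R R'
  InfDisjointPathsAvoiding-mono C'⊆C (P , disjoint , between) =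
    P , disjoint , λ m → let (starts , ends , avoids) = between m in
                         starts , ends , λ v v∈ → avoids v v∈ ∘ C'⊆C v

  InfDisjointPathsAvoiding-sym : ∀ {C R R'} →
    InfDisjointPathsAvoiding G C R R' → InfDisjointPathsAvoiding G C R' R
  InfDisjointPathsAvoiding-sym {R = R} {R'} (P , disjoint , between) =
    reverse ∘ P ,
    (λ m m' m≢m' v v∈ v∈' → disjoint m m' m≢m' v (∈-reverse (P m) v∈) (∈-reverse (P m') v∈')) ,
    λ m → let (starts , ends , avoids) = between m in
          subst (_∈ᵣ R') (sym (reverse-first (P m))) ends ,
          subst (_∈ᵣ R) (sym (reverse-last (P m))) starts ,
          λ v v∈ → avoids v (∈-reverse (P m) v∈)

  module _ {n} (R : Fin n → Ray G) where

    LinearlyOrdered : Set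
    LinearlyOrdered = ∀ (k i l : Fin n) → toℕ k < toℕ i → toℕ i < toℕ l →
                        ¬ EquivIn-G-minus G (VR G (R i)) (R k) (R l)

    EdgesConsecutive : Set
    EdgesConsecutive = ∀ a b → RayGraphAdj G R a b → Consecutive a b

  module _ {n} {R : Fin n → Ray G} where

    RayGraphAdj-sym : ∀ {a b} → RayGraphAdj G R a b → RayGraphAdj G R b a
    RayGraphAdj-sym {a} {b} (a≢b , paths) =
      a≢b ∘ sym ,
      InfDisjointPathsAvoiding-mono {OtherRays G R a b} {OtherRays G R b a} {R b} {R a}
        (λ { v (k , k≢b , k≢a , v∈k) → k , k≢a , k≢b , v∈k })
        (InfDisjointPathsAvoiding-sym {R = R a} {R b} paths)

    short⇒linearlyOrdered : ¬ 3 ≤ n → LinearlyOrdered R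
    short⇒linearlyOrdered n≱3 k i l k<i i<l =
      contradiction (≤-trans (s≤s (≤-trans (s≤s (≤-trans (s≤s z≤n) k<i)) i<l)) (toℕ<n l)) n≱3

    linearlyOrdered⇒ascending-edge : LinearlyOrdered R → ∀ {a b} → toℕ a < toℕ b →
                                     RayGraphAdj G R a b → suc (toℕ a) ≡ toℕ b
    linearlyOrdered⇒ascending-edge linear {a} {b} a<b (_ , paths) with m≤n⇒m<n∨m≡n a<b
    ... | inj₂ 1+a≡b = 1+a≡b
    ... | inj₁ 1+a<b = contradiction
            (InfDisjointPathsAvoiding-mono {OtherRays G R a b} {VR G (R i)} {R a} {R b} R-i⊆others paths)
            (linear a i b a<i i<b)
      where
      i = fromℕ< (<-trans 1+a<b (toℕ<n b))
      a<i : toℕ a < toℕ i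
      a<i = ≤-reflexive (sym (toℕ-fromℕ< (<-trans 1+a<b (toℕ<n b))))
      i<b : toℕ i < toℕ b
      i<b = subst (_< toℕ b) (sym (toℕ-fromℕ< (<-trans 1+a<b (toℕ<n b)))) 1+a<b
      R-i⊆others : ∀ v → v ∈ᵣ R i → OtherRays G R a b v
      R-i⊆others v v∈i = i , (λ i≡a → <⇒≢ a<i (cong toℕ (sym i≡a))) ,
                             (λ i≡b → <⇒≢ i<b (cong toℕ i≡b)) , v∈i

    linearlyOrdered⇒edgesConsecutive : LinearlyOrdered R → EdgesConsecutive R
    linearlyOrdered⇒edgesConsecutive linear a b edge with <-cmp (toℕ a) (toℕ b)
    ... | tri< a<b _ _ = inj₁ (linearlyOrdered⇒ascending-edge linear a<b edge)
    ... | tri≈ _ a≡b _ = contradiction (toℕ-injective a≡b) (proj₁ edge)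
    ... | tri> _ _ b<a = inj₂ (linearlyOrdered⇒ascending-edge linear b<a (RayGraphAdj-sym edge))

  module _ {m n} (σ : Fin m ↔ Fin n) {R : Fin n → Ray G} where
    open Inverse σ using (to; from; strictlyInverseˡ)

    private
      to-injective : ∀ {a b} → to a ≡ to b → a ≡ b
      to-injective = Injection.injective (↔⇒↣ σ)

    DisjointFamilyOf-reindex : ∀ {ω} → DisjointFamilyOf G ω n R → DisjointFamilyOf G ω m (R ∘ to)
    DisjointFamilyOf-reindex (in-ω , disjoint) =
      in-ω ∘ to , λ i j i≢j → disjoint (to i) (to j) (i≢j ∘ to-injective)

    RayGraphAdj-reindex : ∀ {a b} → RayGraphAdj G (R ∘ to) a b ⇔ RayGraphAdj G R (to a) (to b)
    RayGraphAdj-reindex {a} {b} = mk⇔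
      (λ (a≢b , paths) → a≢b ∘ to-injective ,
        InfDisjointPathsAvoiding-mono {OtherRays G (R ∘ to) a b} {OtherRays G R (to a) (to b)}
                                      {R (to a)} {R (to b)} others-pulled-back paths)
      (λ (a≢b , paths) → a≢b ∘ cong to ,
        InfDisjointPathsAvoiding-mono {OtherRays G R (to a) (to b)} {OtherRays G (R ∘ to) a b}
                                      {R (to a)} {R (to b)} others-pushed-forward paths)
      where
      others-pushed-forward : ∀ v → OtherRays G (R ∘ to) a b v → OtherRays G R (to a) (to b) v
      others-pushed-forward v (k , k≢a , k≢b , v∈k) =
        to k , k≢a ∘ to-injective , k≢b ∘ to-injective , v∈k
      others-pulled-back : ∀ v → OtherRays G R (to a) (to b) v → OtherRays G (R ∘ to) a b v
      others-pulled-back v (k , k≢a , k≢b , v∈k) =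
        from k ,
        (λ e → k≢a (trans (sym (strictlyInverseˡ k)) (cong to e))) ,
        (λ e → k≢b (trans (sym (strictlyInverseˡ k)) (cong to e))) ,
        subst (λ r → v ∈ᵣ R r) (sym (strictlyInverseˡ k)) v∈k

module Crossing (em : ExcludedMiddle 0ℓ) (G : Graph) {n} (R : Fin n → Ray G)
                (disjoint : ∀ i j → i ≢ j → DisjointRays G (R i) (R j)) (S : Fin n → Set) where
  open Classical em
  open Paths G

  record CrossingSegment (P : Path G) (a b : Fin n) : Set where
    field
      a∈S           : S a
      b∉S           : ¬ S b
      segment       : Path G
      segment⊆P     : ∀ v → v ∈ₚ segment → v ∈ₚ P
      starts        : Path.first segment ∈ᵣ R a
      ends          : Path.last segment ∈ᵣ R b
      avoids-others : ∀ v → v ∈ₚ segment → ¬ OtherRays G R a b v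

  module _ (P : Path G) where

    OnRay : ℕ → Set
    OnRay k = ∃ λ r → vertexAt P k ∈ᵣ R r

    OnRayOutside : ℕ → Set
    OnRayOutside k = ∃ λ r → ¬ S r × vertexAt P k ∈ᵣ R r

    crossingSegment : ∀ {i j a b} (i≤j : i ≤ j) (j≤L : j ≤ Path.len P) → S a → ¬ S b →
                      vertexAt P i ∈ᵣ R a → vertexAt P j ∈ᵣ R b →
                      (∀ k → i < k → k < j → ¬ OnRay k) → CrossingSegment P a b
    crossingSegment {i} {j} {a} {b} i≤j j≤L a∈S b∉S i∈a j∈b interior-off-rays = record
      { a∈S           = a∈S
      ; b∉S           = b∉S
      ; segment       = subpath P i≤j j≤L
      ; segment⊆P     = λ v v∈ → let (k , _ , _ , eq) = ∈-subpath P i≤j j≤L v∈ in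
                                 subst (_∈ₚ P) eq (vertexAt-∈ P k)
      ; starts        = subst (_∈ᵣ R a) (sym (subpath-first P i≤j j≤L)) i∈a
      ; ends          = subst (_∈ᵣ R b) (sym (subpath-last P i≤j j≤L)) j∈b
      ; avoids-others = avoids-others
      }
      where
      avoids-others : ∀ v → v ∈ₚ subpath P i≤j j≤L → ¬ OtherRays G R a b v
      avoids-others v v∈ (d , d≢a , d≢b , v∈d) with ∈-subpath P i≤j j≤L v∈
      ... | k , i≤k , k≤j , refl with m≤n⇒m<n∨m≡n i≤k | m≤n⇒m<n∨m≡n k≤j
      ...   | inj₂ refl | _         = disjoint d a d≢a _ v∈d i∈a
      ...   | inj₁ _    | inj₂ refl = disjoint d b d≢b _ v∈d j∈b
      ...   | inj₁ i<k  | inj₁ k<j  = interior-off-rays k i<k k<j (d , v∈d)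

    module _ {s t} (s∈S : S s) (t∉S : ¬ S t)
             (first∈s : Path.first P ∈ᵣ R s) (last∈t : Path.last P ∈ᵣ R t) where
      private
        0∈s : vertexAt P 0 ∈ᵣ R s
        0∈s = subst (_∈ᵣ R s) (sym (vertexAt-first P)) first∈s

        L-outside : OnRayOutside (Path.len P)
        L-outside = t , t∉S , subst (_∈ᵣ R t) (sym (vertexAt-last P)) last∈t

      -- The segment runs from the last vertex on a ray before the first vertex on a ray outside S.
      path⇒crossingSegment : ∃₂ (CrossingSegment P)
      path⇒crossingSegment with least-witness {OnRayOutside} (Path.len P) L-outside
      ... | zero , (b , b∉S , 0∈b) , _ = ⊥-elim (disjoint s b (λ { refl → b∉S s∈S }) _ 0∈s 0∈b)
      ... | suc j , (b , b∉S , j∈b) , before-exit with greatest-witness {OnRay} (s , 0∈s) j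
      ... | i , i≤j , (a , i∈a) , after-entry =
        a , b , crossingSegment (m≤n⇒m≤1+n i≤j) 1+j≤L a∈S b∉S i∈a j∈b
                                (λ k i<k k<1+j → after-entry k i<k (s≤s⁻¹ k<1+j))
        where
        1+j≤L : suc j ≤ Path.len P
        1+j≤L = ≮⇒≥ λ L<1+j → before-exit _ L<1+j L-outside
        a∈S : S a
        a∈S = dne λ a∉S → before-exit i (s≤s i≤j) (a , a∉S , i∈a)

  crossingSegments⇒edge : ∀ {a b} (P : ℕ → Path G) → (∀ m m' → m ≢ m' → DisjointPaths G (P m) (P m')) →
                          (∀ m → CrossingSegment (P m) a b) → RayGraphAdj G R a b
  crossingSegments⇒edge P P-disjoint segments =
    (λ { refl → b∉S a∈S }) ,
    segment ∘ segments ,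
    (λ m m' m≢m' v v∈m v∈m' →
      P-disjoint m m' m≢m' v (segment⊆P (segments m) v v∈m) (segment⊆P (segments m') v v∈m')) ,
    λ m → starts (segments m) , ends (segments m) , avoids-others (segments m)
    where
    open CrossingSegment (segments 0) using (a∈S; b∉S)
    open CrossingSegment using (segment; segment⊆P; starts; ends; avoids-others)

  private
    withEndpoints : ∀ {P a b} (c : ∃₂ (CrossingSegment P)) → (proj₁ c , proj₁ (proj₂ c)) ≡ (a , b) →
                    CrossingSegment P a b
    withEndpoints (_ , _ , c) refl = c

  crossing⇒edge : ∀ {C s t} → S s → ¬ S t → InfDisjointPathsAvoiding G C (R s) (R t) →
                  ∃₂ λ a b → S a × ¬ S b × (∃ λ v → v ∈ᵣ R b × ¬ C v) × RayGraphAdj G R a b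
  crossing⇒edge s∈S t∉S (P , P-disjoint , P-between) =
    let (a , b) , often = infinite-pigeonhole *↔× endpoints
        g , g-injective , g-endpoints = infinite-subsequence often
        segments m = withEndpoints (crossing (g m)) (g-endpoints m)
        open CrossingSegment (segments 0)
        last∈P = segment⊆P _ (_ , refl)
    in a , b , a∈S , b∉S , (_ , ends , proj₂ (proj₂ (P-between (g 0))) _ last∈P) ,
       crossingSegments⇒edge (P ∘ g) (λ m m' m≢m' → P-disjoint (g m) (g m') (m≢m' ∘ g-injective))
                             segments
    where
    crossing : ∀ m → ∃₂ (CrossingSegment (P m))
    crossing m = path⇒crossingSegment (P m) s∈S t∉S (proj₁ (P-between m)) (proj₁ (proj₂ (P-between m)))
    endpoints : ℕ → Fin n × Fin n
    endpoints m = proj₁ (crossing m) , proj₁ (proj₂ (crossing m))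

module FamiliesInEnd (em : ExcludedMiddle 0ℓ) (G : Graph) (ω : End G) {n} {R : Fin n → Ray G}
                     (family : DisjointFamilyOf G ω n R) where
  open RayGraphs G
  open Paths G

  module Cut (S : Fin n → Set) = Crossing em G R (proj₂ family) S

  edgesConsecutive⇒linearlyOrdered : EdgesConsecutive R → LinearlyOrdered R
  edgesConsecutive⇒linearlyOrdered consecutive k i l k<i i<l paths =
    no-crossing-edge (Cut.crossing⇒edge (λ x → toℕ x < toℕ i) k<i (<-asym i<l) paths)
    where
    no-crossing-edge : ¬ ∃₂ λ a b → toℕ a < toℕ i × ¬ toℕ b < toℕ i ×
                                    (∃ λ v → v ∈ᵣ R b × ¬ v ∈ᵣ R i) × RayGraphAdj G R a b
    no-crossing-edge (a , b , a<i , b≮i , (v , v∈b , v∉i) , edge) with consecutive a b edge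
    ... | inj₁ 1+a≡b = v∉i (subst (λ r → v ∈ᵣ R r) b≡i v∈b)
      where
      b≡i : b ≡ i
      b≡i = toℕ-injective (≤-antisym (subst (_≤ toℕ i) 1+a≡b a<i) (≮⇒≥ b≮i))
    ... | inj₂ 1+b≡a = b≮i (<-trans (≤-reflexive 1+b≡a) a<i)

  edgesConsecutive⇒successor-edge : EdgesConsecutive R → ∀ {a b} → suc (toℕ a) ≡ toℕ b →
                                    RayGraphAdj G R a b
  edgesConsecutive⇒successor-edge consecutive {a} {b} 1+a≡b =
    crossing-edge-is-ab (Cut.crossing⇒edge (λ x → toℕ x ≤ toℕ a)
                          ≤-refl (λ b≤a → 1+n≰n (subst (_≤ toℕ a) (sym 1+a≡b) b≤a)) Rₐ∼R_b)
    where
    Rₐ∼R_b : Equiv G (R a) (R b)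
    Rₐ∼R_b = Equivalence.to (End.isClass ω (R a) (R b) (proj₁ family a)) (proj₁ family b)

    crossing-edge-is-ab : (∃₂ λ a' b' → toℕ a' ≤ toℕ a × ¬ toℕ b' ≤ toℕ a ×
                                        (∃ λ v → v ∈ᵣ R b' × ¬ NoVertices G v) × RayGraphAdj G R a' b') →
                          RayGraphAdj G R a b
    crossing-edge-is-ab (a' , b' , a'≤a , b'≰a , _ , edge) with consecutive a' b' edge
    ... | inj₂ 1+b'≡a' = contradiction (≤-trans (≤-trans (n≤1+n _) (≤-reflexive 1+b'≡a')) a'≤a) b'≰a
    ... | inj₁ 1+a'≡b' = subst₂ (RayGraphAdj G R) (toℕ-injective a'≡a) (toℕ-injective b'≡b) edge
      where
      a'≡a : toℕ a' ≡ toℕ a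
      a'≡a = ≤-antisym a'≤a (s≤s⁻¹ (subst (suc (toℕ a) ≤_) (sym 1+a'≡b') (≰⇒> b'≰a)))
      b'≡b : toℕ b' ≡ toℕ b
      b'≡b = trans (sym 1+a'≡b') (trans (cong suc a'≡a) 1+a≡b)

  linearlyOrdered⇒edges⇔consecutive : LinearlyOrdered R → ∀ a b → RayGraphAdj G R a b ⇔ Consecutive a b
  linearlyOrdered⇒edges⇔consecutive linear a b = mk⇔ (consecutive a b) λ
    { (inj₁ 1+a≡b) → edgesConsecutive⇒successor-edge consecutive 1+a≡b
    ; (inj₂ 1+b≡a) → RayGraphAdj-sym {R = R} (edgesConsecutive⇒successor-edge consecutive 1+b≡a) }
    where
    consecutive = linearlyOrdered⇒edgesConsecutive {R = R} linear

lemma3p5 : ExcludedMiddle 0ℓ → (G : Graph) → (ω : End G) →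
    Linear G ω ⇔
      (∀ (n : ℕ) (R : Fin n → Ray G) → 1 ≤ n → DisjointFamilyOf G ω n R →
        IsPathGraph n (RayGraphAdj G R))
lemma3p5 em G ω = mk⇔ linear⇒path path⇒linear
  where
  open RayGraphs G

  linear⇒path : Linear G ω → ∀ n R → 1 ≤ n → DisjointFamilyOf G ω n R → IsPathGraph n (RayGraphAdj G R)
  linear⇒path linear n R _ family =
    let σ , ordered = ordering
        edges⇔consecutive = FamiliesInEnd.linearlyOrdered⇒edges⇔consecutive em G ω
                              (DisjointFamilyOf-reindex σ {R} {ω} family) ordered
    in σ , λ a b → edges⇔consecutive a b ⇔-∘ ⇔-sym (RayGraphAdj-reindex σ {R})
    where
    ordering : Σ (Fin n ↔ Fin n) λ σ → LinearlyOrdered (R ∘ Inverse.to σ)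
    ordering with 3 ≤? n
    ... | yes 3≤n = linear n R 3≤n family
    ... | no n≱3  = ↔-id (Fin n) , short⇒linearlyOrdered {R = R} n≱3

  path⇒linear : (∀ n R → 1 ≤ n → DisjointFamilyOf G ω n R → IsPathGraph n (RayGraphAdj G R)) → Linear G ω
  path⇒linear path n R 3≤n family =
    let σ , edges⇔consecutive = path n R (≤-trans (s≤s z≤n) 3≤n) family
    in σ , FamiliesInEnd.edgesConsecutive⇒linearlyOrdered em G ω (DisjointFamilyOf-reindex σ {R} {ω} family)
             λ a b → Equivalence.to (edges⇔consecutive a b) ∘ Equivalence.to (RayGraphAdj-reindex σ {R})
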